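{- Let $V$ be a finite set and $k\le |V|$. If $C_1,\dots,C_s,D_1,\dots,D_s\subseteq V$ satisfy $|C_i|=|D_i|$ for all $i$ and the $D_i$ are pairwise disjoint, and $A$ is uniform from $\binom{V}{k}$, then $$\Pr(A\cap C_i\neq\emptyset\ \forall i)\ge\Pr(A\cap D_i\neq\emptyset\ \forall i).$$ -}

module Defs where

open import Data.Nat using (ℕ; zero; suc)
open import Data.Nat.Properties using (_≟_)
open import Data.Bool using (true; false)
open import Data.Fin using (Fin)
open import Data.Fin.Properties using (all?)
open import Data.Fin.Subset using (Subset; _∩_; ∣_∣; Nonempty)
open import Data.Fin.Subset.Properties using (nonempty?)
open import Data.List using (List; []; _∷_; map; _++_; filter; length)
open import Data.Vec using ([]; _∷_)
open import Relation.Nullary using (Dec)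

allSubsets : (n : ℕ) → List (Subset n)
allSubsets zero = [] ∷ []
allSubsets (suc n) = map (true ∷_) (allSubsets n) ++ map (false ∷_) (allSubsets n)

kSubsets : (n k : ℕ) → List (Subset n)
kSubsets n k = filter (λ A → ∣ A ∣ ≟ k) (allSubsets n)

HitsAll : {n s : ℕ} → (Fin s → Subset n) → Subset n → Set
HitsAll F A = ∀ i → Nonempty (A ∩ F i)

hitsAll? : {n s : ℕ} → (F : Fin s → Subset n) → (A : Subset n) → Dec (HitsAll F A)
hitsAll? F A = all? (λ i → nonempty? (A ∩ F i))

-- Number of k-subsets A of Fin n with A ∩ F i ≠ ∅ for all i.
-- Pr(A ∩ F i ≠ ∅ ∀ i) for A uniform in (V choose k) equals this count divided by
-- length (kSubsets n k) = (n choose k).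
countHitting : (n k : ℕ) → {s : ℕ} → (Fin s → Subset n) → ℕ
countHitting n k F = length (filter (hitsAll? F) (kSubsets n k))

module Submission where

open import Defs
open import Data.Nat using (ℕ; _≤_)
open import Data.Fin using (Fin)
open import Data.Fin.Subset using (Subset; _∩_; ∣_∣; Empty)
open import Relation.Binary.PropositionalEquality using (_≡_; _≢_)

open import Data.Bool using (Bool; true; false; if_then_else_)
open import Data.Empty using (⊥-elim)
open import Data.Fin using (zero; suc)
open import Data.Fin.Permutation using (Permutation′; permutation)
import Data.Fin.Properties as FinP
open import Data.Fin.Subset using (Nonempty; _∈_; _∉_; _⊆_; ∁)
open import Data.Fin.Subset.Properties
  using (_∈?_; nonempty?; x∈p∩q⁺; x∈p∩q⁻; x∈∁p⇒x∉p; x∉p⇒x∈∁p; p⊆q⇒∣p∣≤∣q∣; p⊂q⇒∣p∣<∣q∣)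
open import Data.List using (List; []; _∷_; map; _++_; filter; length)
open import Data.List.Properties using (map-++; map-∘)
open import Data.Nat using (zero; suc; _+_; _<_; z≤n; s≤s)
open import Data.Nat.Induction using (<-wellFounded)
open import Data.Nat.ListAction using (sum)
open import Data.Nat.ListAction.Properties using (sum-++)
open import Data.Nat.Properties
  using (_≟_; ≤-refl; ≤-reflexive; ≤-trans; ≤-antisym; <⇒≱; +-mono-≤; +-mono-<-≤; +-mono-≤-<;
         +-comm; +-identityʳ; m≤m+n; m≤n+m; +-cancelʳ-≤; +-commutativeSemigroup; +-0-commutativeMonoid; module ≤-Reasoning)
open import Data.Product using (∃; _×_; _,_; proj₂)
open import Data.Sum using (_⊎_; inj₁; inj₂)
open import Data.Vec using ([]; _∷_; lookup; _[_]≔_)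
open import Data.Vec.Functional using (updateAt)
open import Data.Vec.Functional.Properties using (updateAt-updates; updateAt-minimal)
open import Data.Vec.Properties using (lookup∘update; lookup∘update′; []=⇒lookup; lookup⇒[]=)
open import Function using (_∘_)
open import Induction.WellFounded using (Acc; acc)
open import Relation.Binary.PropositionalEquality using (refl; sym; trans; cong; cong₂; subst; module ≡-Reasoning)
open import Relation.Nullary using (Dec; does; yes; no; ¬_)
open import Relation.Nullary.Decidable using (_×-dec_; ¬?; decidable-stable)

open import Algebra.Properties.CommutativeSemigroup +-commutativeSemigroup using (interchange)
open import Algebra.Properties.CommutativeMonoid.Sum +-0-commutativeMonoid
  using (sum-syntax; ∑-comm; sum-cong-≗; sum-permute; sum-replicate-zero)

open FinP using () renaming (_≟_ to _≟ᶠ_)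

-- Proof strategy.  countHitting is rewritten as a sum of an indicator over
-- the Boolean cube of all subsets of Fin n (count≡sumSubsets).  Swapping two
-- coordinates is a symmetry of the cube (sumSubsets-τ); hence transposing two
-- points in every member of a family preserves the count (count-τ), and an
-- exchange principle compares two events (sumSubsets-exchange).  From it:
-- compressing x ∈ C j onto a point y lying in no member does not increase the
-- count (count-shift).
-- Phase 1 (disjointify): while two members of C overlap at x, double counting
-- (∑ ∣C i∣ = ∑ ∣D i∣ ≤ n) provides a free point y; compress x to y.
-- Phase 2 (disjoint-count): for disjoint C and D of equal sizes, transpose a
-- point x ∈ C j ∖ D j with y ∈ D j ∖ C j in all of C, until D j ⊆ C j for all
-- j; the count is monotone under inclusion (count-mono).

ind : ∀ {p} {P : Set p} → Dec P → ℕ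
ind d = if does d then 1 else 0

ind-mono : ∀ {p q} {P : Set p} {Q : Set q} → (P → Q) → (P? : Dec P) (Q? : Dec Q) → ind P? ≤ ind Q?
ind-mono f (yes p) (yes q) = ≤-refl
ind-mono f (yes p) (no ¬q) = ⊥-elim (¬q (f p))
ind-mono f (no ¬p) Q? = z≤n

ind-cong : ∀ {p q} {P : Set p} {Q : Set q} → (P → Q) → (Q → P) → (P? : Dec P) (Q? : Dec Q) → ind P? ≡ ind Q?
ind-cong f g P? Q? = ≤-antisym (ind-mono f P? Q?) (ind-mono g Q? P?)

ind-< : ∀ {p q} {P : Set p} {Q : Set q} → ¬ P → Q → (P? : Dec P) (Q? : Dec Q) → ind P? < ind Q?
ind-< ¬p q (yes p) Q? = ⊥-elim (¬p p)
ind-< ¬p q (no _) (yes _) = s≤s z≤n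
ind-< ¬p q (no _) (no ¬q) = ⊥-elim (¬q q)

ind-yes : ∀ {p} {P : Set p} → P → (P? : Dec P) → ind P? ≡ 1
ind-yes p (yes _) = refl
ind-yes p (no ¬p) = ⊥-elim (¬p p)

∑-mono : ∀ {n} {f g : Fin n → ℕ} → (∀ i → f i ≤ g i) → ∑[ i < n ] f i ≤ ∑[ i < n ] g i
∑-mono {zero} f≤g = z≤n
∑-mono {suc n} f≤g = +-mono-≤ (f≤g zero) (∑-mono (f≤g ∘ suc))

∑-mono-< : ∀ {n} {f g : Fin n → ℕ} → (∀ i → f i ≤ g i) → ∀ j → f j < g j → ∑[ i < n ] f i < ∑[ i < n ] g i
∑-mono-< {suc n} f≤g zero fj<gj = +-mono-<-≤ fj<gj (∑-mono (f≤g ∘ suc))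
∑-mono-< {suc n} f≤g (suc j) fj<gj = +-mono-≤-< (f≤g zero) (∑-mono-< (f≤g ∘ suc) j fj<gj)

∑-term : ∀ {n} (f : Fin n → ℕ) i → f i ≤ ∑[ i < n ] f i
∑-term f zero = m≤m+n (f zero) _
∑-term f (suc i) = ≤-trans (∑-term (f ∘ suc) i) (m≤n+m _ (f zero))

∑-two-terms : ∀ {n} (f : Fin n → ℕ) {i j} → i ≢ j → f i + f j ≤ ∑[ i < n ] f i
∑-two-terms f {zero} {zero} i≢j = ⊥-elim (i≢j refl)
∑-two-terms f {zero} {suc j} i≢j = +-mono-≤ ≤-refl (∑-term (f ∘ suc) j)
∑-two-terms f {suc i} {zero} i≢j =
  ≤-trans (≤-reflexive (+-comm (f (suc i)) (f zero))) (+-mono-≤ ≤-refl (∑-term (f ∘ suc) i))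
∑-two-terms f {suc i} {suc j} i≢j = ≤-trans (∑-two-terms (f ∘ suc) (i≢j ∘ cong suc)) (m≤n+m _ (f zero))

∑-ones : ∀ n → ∑[ i < n ] 1 ≡ n
∑-ones zero = refl
∑-ones (suc n) = cong suc (∑-ones n)

∑-ind-≤1 : ∀ {s} {P : Fin s → Set} (P? : ∀ i → Dec (P i)) → (∀ i j → P i → P j → i ≡ j) →
  ∑[ i < s ] ind (P? i) ≤ 1
∑-ind-≤1 {zero} P? unique = z≤n
∑-ind-≤1 {suc s} P? unique with P? zero
... | no _ = ∑-ind-≤1 (P? ∘ suc) (λ i j p q → FinP.suc-injective (unique (suc i) (suc j) p q))
... | yes p₀ = s≤s (≤-trans (∑-mono none) (≤-reflexive (sum-replicate-zero s)))
  where
  none : ∀ i → ind (P? (suc i)) ≤ 0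
  none i with P? (suc i)
  ... | yes p = ⊥-elim (FinP.0≢1+n (unique zero (suc i) p₀ p))
  ... | no _ = z≤n

∣∣≡∑∈ : ∀ {n} (A : Subset n) → ∣ A ∣ ≡ ∑[ e < n ] ind (e ∈? A)
∣∣≡∑∈ [] = refl
∣∣≡∑∈ (true ∷ A) = cong suc (∣∣≡∑∈ A)
∣∣≡∑∈ (false ∷ A) = ∣∣≡∑∈ A

sumSubsets : (n : ℕ) → (Subset n → ℕ) → ℕ
sumSubsets zero f = f []
sumSubsets (suc n) f = sumSubsets n (f ∘ (true ∷_)) + sumSubsets n (f ∘ (false ∷_))

sumSubsets-cong : ∀ n {f g : Subset n → ℕ} → (∀ A → f A ≡ g A) → sumSubsets n f ≡ sumSubsets n g
sumSubsets-cong zero f≡g = f≡g []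
sumSubsets-cong (suc n) f≡g = cong₂ _+_ (sumSubsets-cong n (f≡g ∘ (true ∷_))) (sumSubsets-cong n (f≡g ∘ (false ∷_)))

sumSubsets-mono : ∀ n {f g : Subset n → ℕ} → (∀ A → f A ≤ g A) → sumSubsets n f ≤ sumSubsets n g
sumSubsets-mono zero f≤g = f≤g []
sumSubsets-mono (suc n) f≤g = +-mono-≤ (sumSubsets-mono n (f≤g ∘ (true ∷_))) (sumSubsets-mono n (f≤g ∘ (false ∷_)))

sumSubsets-+ : ∀ n (f g : Subset n → ℕ) → sumSubsets n (λ A → f A + g A) ≡ sumSubsets n f + sumSubsets n g
sumSubsets-+ zero f g = refl
sumSubsets-+ (suc n) f g = trans
  (cong₂ _+_ (sumSubsets-+ n (f ∘ (true ∷_)) (g ∘ (true ∷_))) (sumSubsets-+ n (f ∘ (false ∷_)) (g ∘ (false ∷_))))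
  (interchange (sumSubsets n (f ∘ (true ∷_))) (sumSubsets n (g ∘ (true ∷_)))
               (sumSubsets n (f ∘ (false ∷_))) (sumSubsets n (g ∘ (false ∷_))))

sum-allSubsets : ∀ n (f : Subset n → ℕ) → sum (map f (allSubsets n)) ≡ sumSubsets n f
sum-allSubsets zero f = +-identityʳ (f [])
sum-allSubsets (suc n) f = begin
  sum (map f (map (true ∷_) L ++ map (false ∷_) L))
    ≡⟨ cong sum (map-++ f (map (true ∷_) L) _) ⟩
  sum (map f (map (true ∷_) L) ++ map f (map (false ∷_) L))
    ≡⟨ sum-++ (map f (map (true ∷_) L)) _ ⟩
  sum (map f (map (true ∷_) L)) + sum (map f (map (false ∷_) L))
    ≡⟨ cong₂ _+_ (cong sum (sym (map-∘ L))) (cong sum (sym (map-∘ L))) ⟩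
  sum (map (f ∘ (true ∷_)) L) + sum (map (f ∘ (false ∷_)) L)
    ≡⟨ cong₂ _+_ (sum-allSubsets n _) (sum-allSubsets n _) ⟩
  sumSubsets (suc n) f ∎
  where
  open ≡-Reasoning
  L = allSubsets n

length-filter-filter : ∀ {A : Set} {P Q : A → Set} (P? : ∀ a → Dec (P a)) (Q? : ∀ a → Dec (Q a)) (L : List A) →
  length (filter P? (filter Q? L)) ≡ sum (map (λ a → ind (Q? a ×-dec P? a)) L)
length-filter-filter P? Q? [] = refl
length-filter-filter P? Q? (a ∷ L) with Q? a
... | no _ = length-filter-filter P? Q? L
... | yes _ with P? a
...   | yes _ = cong suc (length-filter-filter P? Q? L)
...   | no _ = length-filter-filter P? Q? L

Hit : ∀ {n s} → ℕ → (Fin s → Subset n) → Subset n → Set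
Hit k F A = ∣ A ∣ ≡ k × HitsAll F A

hit? : ∀ {n s} (k : ℕ) (F : Fin s → Subset n) (A : Subset n) → Dec (Hit k F A)
hit? k F A = (∣ A ∣ ≟ k) ×-dec hitsAll? F A

count≡sumSubsets : ∀ {n s} k (F : Fin s → Subset n) → countHitting n k F ≡ sumSubsets n (ind ∘ hit? k F)
count≡sumSubsets {n} k F =
  trans (length-filter-filter (hitsAll? F) (λ A → ∣ A ∣ ≟ k) (allSubsets n)) (sum-allSubsets n _)

-- Fin n into Fin (suc n), sending q to the new first point and e ≠ q to suc e:
-- coordinate e of A [ q ]≔ b sits at coordinate bump q e of b ∷ A.
bump : ∀ {n} → Fin n → Fin n → Fin (suc n)
bump q e with e ≟ᶠ q
... | yes _ = zero
... | no _ = suc e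

bump-self : ∀ {n} (q : Fin n) → bump q q ≡ zero
bump-self q with q ≟ᶠ q
... | yes _ = refl
... | no q≢q = ⊥-elim (q≢q refl)

bump-other : ∀ {n} (q e : Fin n) → e ≢ q → bump q e ≡ suc e
bump-other q e e≢q with e ≟ᶠ q
... | yes e≡q = ⊥-elim (e≢q e≡q)
... | no _ = refl

-- The transposition τ p q of Fin n, by recursion matching τˢ below.
τ : ∀ {n} → Fin n → Fin n → Fin n → Fin n
τ zero zero e = e
τ zero (suc q) zero = suc q
τ zero (suc q) (suc e) = bump q e
τ (suc p) zero zero = suc p
τ (suc p) zero (suc e) = bump p e
τ (suc p) (suc q) zero = zero
τ (suc p) (suc q) (suc e) = suc (τ p q e)

τ-left : ∀ {n} (p q : Fin n) → τ p q p ≡ q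
τ-left zero zero = refl
τ-left zero (suc q) = refl
τ-left (suc p) zero = bump-self p
τ-left (suc p) (suc q) = cong suc (τ-left p q)

τ-right : ∀ {n} (p q : Fin n) → τ p q q ≡ p
τ-right zero zero = refl
τ-right zero (suc q) = bump-self q
τ-right (suc p) zero = refl
τ-right (suc p) (suc q) = cong suc (τ-right p q)

τ-other : ∀ {n} (p q e : Fin n) → e ≢ p → e ≢ q → τ p q e ≡ e
τ-other zero zero e e≢p e≢q = refl
τ-other zero (suc q) zero e≢p e≢q = ⊥-elim (e≢p refl)
τ-other zero (suc q) (suc e) e≢p e≢q = bump-other q e (e≢q ∘ cong suc)
τ-other (suc p) zero zero e≢p e≢q = ⊥-elim (e≢q refl)
τ-other (suc p) zero (suc e) e≢p e≢q = bump-other p e (e≢p ∘ cong suc)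
τ-other (suc p) (suc q) zero e≢p e≢q = refl
τ-other (suc p) (suc q) (suc e) e≢p e≢q = cong suc (τ-other p q e (e≢p ∘ cong suc) (e≢q ∘ cong suc))

τ-involutive : ∀ {n} (p q e : Fin n) → τ p q (τ p q e) ≡ e
τ-involutive p q e with e ≟ᶠ p | e ≟ᶠ q
... | yes refl | _ = trans (cong (τ p q) (τ-left p q)) (τ-right p q)
... | no _ | yes refl = trans (cong (τ p q) (τ-right p q)) (τ-left p q)
... | no e≢p | no e≢q = trans (cong (τ p q) (τ-other p q e e≢p e≢q)) (τ-other p q e e≢p e≢q)

τ-permutation : ∀ {n} (p q : Fin n) → Permutation′ n
τ-permutation p q = permutation (τ p q) (τ p q) (τ-involutive p q) (τ-involutive p q)

τˢ : ∀ {n} → Fin n → Fin n → Subset n → Subset n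
τˢ zero zero A = A
τˢ zero (suc q) (b ∷ A) = lookup A q ∷ (A [ q ]≔ b)
τˢ (suc p) zero (b ∷ A) = lookup A p ∷ (A [ p ]≔ b)
τˢ (suc p) (suc q) (b ∷ A) = b ∷ τˢ p q A

lookup-≔ : ∀ {n} (q e : Fin n) (b : Bool) (A : Subset n) → lookup (A [ q ]≔ b) e ≡ lookup (b ∷ A) (bump q e)
lookup-≔ q e b A with e ≟ᶠ q
... | yes refl = lookup∘update q A b
... | no e≢q = lookup∘update′ e≢q A b

lookup-τˢ : ∀ {n} (p q : Fin n) (A : Subset n) (e : Fin n) → lookup (τˢ p q A) e ≡ lookup A (τ p q e)
lookup-τˢ zero zero A e = refl
lookup-τˢ zero (suc q) (b ∷ A) zero = refl
lookup-τˢ zero (suc q) (b ∷ A) (suc e) = lookup-≔ q e b A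
lookup-τˢ (suc p) zero (b ∷ A) zero = refl
lookup-τˢ (suc p) zero (b ∷ A) (suc e) = lookup-≔ p e b A
lookup-τˢ (suc p) (suc q) (b ∷ A) zero = refl
lookup-τˢ (suc p) (suc q) (b ∷ A) (suc e) = lookup-τˢ p q A e

∈τˢ⁻ : ∀ {n} (p q : Fin n) {A : Subset n} {e : Fin n} → e ∈ τˢ p q A → τ p q e ∈ A
∈τˢ⁻ p q {A} {e} e∈ = lookup⇒[]= _ A (trans (sym (lookup-τˢ p q A e)) ([]=⇒lookup e∈))

∈τˢ⁺ : ∀ {n} (p q : Fin n) {A : Subset n} {e : Fin n} → τ p q e ∈ A → e ∈ τˢ p q A
∈τˢ⁺ p q {A} {e} τe∈ = lookup⇒[]= e (τˢ p q A) (trans (lookup-τˢ p q A e) ([]=⇒lookup τe∈))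

∣τˢ∣ : ∀ {n} (p q : Fin n) (A : Subset n) → ∣ τˢ p q A ∣ ≡ ∣ A ∣
∣τˢ∣ {n} p q A = begin
  ∣ τˢ p q A ∣                      ≡⟨ ∣∣≡∑∈ (τˢ p q A) ⟩
  ∑[ e < n ] ind (e ∈? τˢ p q A)    ≡⟨ sum-cong-≗ (λ e → ind-cong (∈τˢ⁻ p q) (∈τˢ⁺ p q) (e ∈? _) (τ p q e ∈? A)) ⟩
  ∑[ e < n ] ind (τ p q e ∈? A)     ≡⟨ sym (sum-permute (λ e → ind (e ∈? A)) (τ-permutation p q)) ⟩
  ∑[ e < n ] ind (e ∈? A)           ≡⟨ sym (∣∣≡∑∈ A) ⟩
  ∣ A ∣ ∎
  where open ≡-Reasoning

-- Splitting off coordinate q: recording the old bit A q and overwriting it by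
-- b, over both values of b, enumerates each pair (bit, set) exactly once.
sumSubsets-split : ∀ n (q : Fin n) (g : Bool → Subset n → ℕ) →
  sumSubsets n (λ A → g (lookup A q) (A [ q ]≔ true)) + sumSubsets n (λ A → g (lookup A q) (A [ q ]≔ false))
  ≡ sumSubsets n (g true) + sumSubsets n (g false)
sumSubsets-split (suc n) zero g =
  interchange (sumSubsets n (g true ∘ (true ∷_))) (sumSubsets n (g false ∘ (true ∷_)))
              (sumSubsets n (g true ∘ (false ∷_))) (sumSubsets n (g false ∘ (false ∷_)))
sumSubsets-split (suc n) (suc q) g = begin
  (Σ (λ A → h (lookup A q) true (A [ q ]≔ true)) + Σ (λ A → h (lookup A q) false (A [ q ]≔ true)))
    + (Σ (λ A → h (lookup A q) true (A [ q ]≔ false)) + Σ (λ A → h (lookup A q) false (A [ q ]≔ false)))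
    ≡⟨ interchange (Σ (λ A → h (lookup A q) true (A [ q ]≔ true))) _ _ _ ⟩
  (Σ (λ A → h (lookup A q) true (A [ q ]≔ true)) + Σ (λ A → h (lookup A q) true (A [ q ]≔ false)))
    + (Σ (λ A → h (lookup A q) false (A [ q ]≔ true)) + Σ (λ A → h (lookup A q) false (A [ q ]≔ false)))
    ≡⟨ cong₂ _+_ (sumSubsets-split n q (λ c → h c true)) (sumSubsets-split n q (λ c → h c false)) ⟩
  (Σ (h true true) + Σ (h false true)) + (Σ (h true false) + Σ (h false false))
    ≡⟨ interchange (Σ (h true true)) _ _ _ ⟩
  (Σ (h true true) + Σ (h true false)) + (Σ (h false true) + Σ (h false false)) ∎
  where
  open ≡-Reasoning
  Σ : (Subset n → ℕ) → ℕ
  Σ = sumSubsets n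
  h : Bool → Bool → Subset n → ℕ
  h c b A = g c (b ∷ A)

-- Swapping two coordinates is a bijection of the cube.
sumSubsets-τ : ∀ n (p q : Fin n) (f : Subset n → ℕ) → sumSubsets n (f ∘ τˢ p q) ≡ sumSubsets n f
sumSubsets-τ n zero zero f = refl
sumSubsets-τ (suc n) zero (suc q) f = sumSubsets-split n q (λ b A → f (b ∷ A))
sumSubsets-τ (suc n) (suc p) zero f = sumSubsets-split n p (λ b A → f (b ∷ A))
sumSubsets-τ (suc n) (suc p) (suc q) f =
  cong₂ _+_ (sumSubsets-τ n p q (f ∘ (true ∷_))) (sumSubsets-τ n p q (f ∘ (false ∷_)))

sumSubsets-exchange : ∀ {n} (x y : Fin n) {P Q : Subset n → Set}
  (P? : ∀ A → Dec (P A)) (Q? : ∀ A → Dec (Q A)) →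
  (∀ A → P A → ¬ Q A → Q (τˢ x y A) × ¬ P (τˢ x y A)) →
  sumSubsets n (ind ∘ P?) ≤ sumSubsets n (ind ∘ Q?)
sumSubsets-exchange {n} x y {P} {Q} P? Q? exchange =
  +-cancelʳ-≤ (Σ (ind ∘ R?)) (Σ (ind ∘ P?)) (Σ (ind ∘ Q?)) (begin
    Σ (ind ∘ P?) + Σ (ind ∘ R?)                 ≡⟨ sumSubsets-+ n (ind ∘ P?) (ind ∘ R?) ⟨
    Σ (λ A → ind (P? A) + ind (R? A))           ≤⟨ sumSubsets-mono n (λ A → pointwise A (P? A) (Q? A)) ⟩
    Σ (λ A → ind (Q? A) + ind (R? (τˢ x y A)))  ≡⟨ sumSubsets-+ n (ind ∘ Q?) (ind ∘ R? ∘ τˢ x y) ⟩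
    Σ (ind ∘ Q?) + Σ (ind ∘ R? ∘ τˢ x y)        ≡⟨ cong (Σ (ind ∘ Q?) +_) (sumSubsets-τ n x y (ind ∘ R?)) ⟩
    Σ (ind ∘ Q?) + Σ (ind ∘ R?)                 ∎)
  where
  open ≤-Reasoning
  Σ : (Subset n → ℕ) → ℕ
  Σ = sumSubsets n
  -- R = Q ∖ P, the sets that τˢ x y receives from P ∖ Q.
  R? : ∀ A → Dec (Q A × ¬ P A)
  R? A = Q? A ×-dec ¬? (P? A)
  pointwise : ∀ A (p? : Dec (P A)) (q? : Dec (Q A)) →
    ind p? + ind (q? ×-dec ¬? p?) ≤ ind q? + ind (R? (τˢ x y A))
  pointwise A (yes p) (yes q) = s≤s z≤n
  pointwise A (yes p) (no ¬q) = ≤-reflexive (sym (ind-yes (exchange A p ¬q) (R? (τˢ x y A))))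
  pointwise A (no ¬p) (yes q) = s≤s z≤n
  pointwise A (no ¬p) (no ¬q) = z≤n

meet : ∀ {n} {A B : Subset n} {e : Fin n} → e ∈ A → e ∈ B → Nonempty (A ∩ B)
meet e∈A e∈B = _ , x∈p∩q⁺ (e∈A , e∈B)

meet⁻ : ∀ {n} {A B : Subset n} → Nonempty (A ∩ B) → ∃ λ e → e ∈ A × e ∈ B
meet⁻ {A = A} {B} (e , e∈A∩B) = e , x∈p∩q⁻ A B e∈A∩B

hitsAll-τ : ∀ {n s} (p q : Fin n) (F : Fin s → Subset n) {A : Subset n} →
  HitsAll F A → HitsAll (τˢ p q ∘ F) (τˢ p q A)
hitsAll-τ p q F h i with meet⁻ (h i)
... | e , e∈A , e∈F = meet (∈τˢ⁺ p q (subst (_∈ _) (sym (τ-involutive p q e)) e∈A))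
                           (∈τˢ⁺ p q (subst (_∈ F i) (sym (τ-involutive p q e)) e∈F))

hitsAll-τ⁻ : ∀ {n s} (p q : Fin n) (F : Fin s → Subset n) {A : Subset n} →
  HitsAll (τˢ p q ∘ F) (τˢ p q A) → HitsAll F A
hitsAll-τ⁻ p q F h i with meet⁻ (h i)
... | e , e∈A , e∈F = meet (∈τˢ⁻ p q e∈A) (∈τˢ⁻ p q e∈F)

count-τ : ∀ {n s} k (p q : Fin n) (F : Fin s → Subset n) →
  countHitting n k (τˢ p q ∘ F) ≡ countHitting n k F
count-τ {n} k p q F = begin
  countHitting n k (τˢ p q ∘ F)                         ≡⟨ count≡sumSubsets k (τˢ p q ∘ F) ⟩
  sumSubsets n (ind ∘ hit? k (τˢ p q ∘ F))              ≡⟨ sumSubsets-τ n p q (ind ∘ hit? k (τˢ p q ∘ F)) ⟨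
  sumSubsets n (ind ∘ hit? k (τˢ p q ∘ F) ∘ τˢ p q)     ≡⟨ sumSubsets-cong n (λ A → ind-cong to from (hit? k _ _) (hit? k F A)) ⟩
  sumSubsets n (ind ∘ hit? k F)                         ≡⟨ count≡sumSubsets k F ⟨
  countHitting n k F ∎
  where
  open ≡-Reasoning
  to : ∀ {A} → Hit k (τˢ p q ∘ F) (τˢ p q A) → Hit k F A
  to {A} (size , h) = trans (sym (∣τˢ∣ p q A)) size , hitsAll-τ⁻ p q F h
  from : ∀ {A} → Hit k F A → Hit k (τˢ p q ∘ F) (τˢ p q A)
  from {A} (size , h) = trans (∣τˢ∣ p q A) size , hitsAll-τ p q F h

count-mono : ∀ {n s} k (D C : Fin s → Subset n) → (∀ i → D i ⊆ C i) → countHitting n k D ≤ countHitting n k C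
count-mono {n} k D C D⊆C = begin
  countHitting n k D              ≡⟨ count≡sumSubsets k D ⟩
  sumSubsets n (ind ∘ hit? k D)   ≤⟨ sumSubsets-mono n (λ A → ind-mono enlarge (hit? k D A) (hit? k C A)) ⟩
  sumSubsets n (ind ∘ hit? k C)   ≡⟨ count≡sumSubsets k C ⟨
  countHitting n k C ∎
  where
  open ≤-Reasoning
  enlarge : ∀ {A} → Hit k D A → Hit k C A
  enlarge (size , h) = size , λ i → let (e , e∈A , e∈D) = meet⁻ (h i) in meet e∈A (D⊆C i e∈D)

Free : ∀ {n s} → (Fin s → Subset n) → Fin n → Set
Free C e = ∀ i → e ∉ C i

free? : ∀ {n s} (C : Fin s → Subset n) (e : Fin n) → Dec (Free C e)
free? C e = FinP.all? (λ i → ¬? (e ∈? C i))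

shift : ∀ {n s} → (Fin s → Subset n) → Fin s → Fin n → Fin n → Fin s → Subset n
shift C j x y = updateAt C j (τˢ x y)

∈shift⁻ : ∀ {n s} (C : Fin s → Subset n) j x y {e} → e ∈ shift C j x y j → τ x y e ∈ C j
∈shift⁻ C j x y e∈ = ∈τˢ⁻ x y (subst (_ ∈_) (updateAt-updates j C) e∈)

∈shift⁺ : ∀ {n s} (C : Fin s → Subset n) j x y {e} → τ x y e ∈ C j → e ∈ shift C j x y j
∈shift⁺ C j x y τe∈ = subst (_ ∈_) (sym (updateAt-updates j C)) (∈τˢ⁺ x y τe∈)

shift-other : ∀ {n s} (C : Fin s → Subset n) j x y i → i ≢ j → shift C j x y i ≡ C i
shift-other C j x y i i≢j = updateAt-minimal i j C i≢j

∣shift∣ : ∀ {n s} (C : Fin s → Subset n) j x y i → ∣ shift C j x y i ∣ ≡ ∣ C i ∣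
∣shift∣ C j x y i with i ≟ᶠ j
... | yes refl = trans (cong ∣_∣ (updateAt-updates i C)) (∣τˢ∣ x y (C i))
... | no i≢j = cong ∣_∣ (shift-other C j x y i i≢j)

module Compression {n s} (C : Fin s → Subset n) (j : Fin s) (x y : Fin n)
                   (x∈Cj : x ∈ C j) (y-free : Free C y) where

  C′ : Fin s → Subset n
  C′ = shift C j x y

  ∈C′ : ∀ {i e} → i ≢ j → e ∈ C′ i → e ∈ C i
  ∈C′ i≢j = subst (_ ∈_) (shift-other C j x y _ i≢j)

  -- A set meeting every member of C′ but not of C must miss C j, contain y and omit x;
  -- its image under (x y) then meets every member of C but not C′ j.
  module _ {A : Subset n} (hits′ : HitsAll C′ A) (misses : ¬ HitsAll C A) where

    misses-j : ¬ Nonempty (A ∩ C j)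
    misses-j with FinP.¬∀⟶∃¬ s (λ i → Nonempty (A ∩ C i)) (λ i → nonempty? (A ∩ C i)) misses
    ... | i , ¬hit-i with i ≟ᶠ j
    ...   | yes refl = ¬hit-i
    ...   | no i≢j = ⊥-elim (¬hit-i (let (e , e∈A , e∈C′) = meet⁻ (hits′ i) in meet e∈A (∈C′ i≢j e∈C′)))

    x∉A : x ∉ A
    x∉A x∈A = misses-j (meet x∈A x∈Cj)

    y∈A : y ∈ A
    y∈A with meet⁻ (hits′ j)
    ... | e , e∈A , e∈C′j with e ≟ᶠ x | e ≟ᶠ y
    ...   | yes refl | _ = ⊥-elim (y-free j (subst (_∈ C j) (τ-left x y) (∈shift⁻ C j x y e∈C′j)))
    ...   | no _ | yes refl = e∈A
    ...   | no e≢x | no e≢y =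
            ⊥-elim (misses-j (meet e∈A (subst (_∈ C j) (τ-other x y e e≢x e≢y) (∈shift⁻ C j x y e∈C′j))))

    swapped-hits : HitsAll C (τˢ x y A)
    swapped-hits i with i ≟ᶠ j
    ... | yes refl = meet (∈τˢ⁺ x y (subst (_∈ A) (sym (τ-left x y)) y∈A)) x∈Cj
    ... | no i≢j with meet⁻ (hits′ i)
    ...   | e , e∈A , e∈C′i = meet (∈τˢ⁺ x y (subst (_∈ A) (sym (τ-other x y e e≢x e≢y)) e∈A)) e∈Ci
      where
      e∈Ci : e ∈ C i
      e∈Ci = ∈C′ i≢j e∈C′i
      e≢x : e ≢ x
      e≢x refl = x∉A e∈A
      e≢y : e ≢ y
      e≢y refl = y-free i e∈Ci

    swapped-misses′ : ¬ HitsAll C′ (τˢ x y A)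
    swapped-misses′ h with meet⁻ (h j)
    ... | e , e∈τA , e∈C′j = misses-j (meet (∈τˢ⁻ x y e∈τA) (∈shift⁻ C j x y e∈C′j))

  count-shift : ∀ k → countHitting n k C′ ≤ countHitting n k C
  count-shift k = begin
    countHitting n k C′              ≡⟨ count≡sumSubsets k C′ ⟩
    sumSubsets n (ind ∘ hit? k C′)   ≤⟨ sumSubsets-exchange x y (hit? k C′) (hit? k C) exchange ⟩
    sumSubsets n (ind ∘ hit? k C)    ≡⟨ count≡sumSubsets k C ⟨
    countHitting n k C ∎
    where
    open ≤-Reasoning
    exchange : ∀ A → Hit k C′ A → ¬ Hit k C A → Hit k C (τˢ x y A) × ¬ Hit k C′ (τˢ x y A)
    exchange A (size , hits′) ¬hit =
      (trans (∣τˢ∣ x y A) size , swapped-hits hits′ misses) , (swapped-misses′ hits′ misses ∘ proj₂)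
      where
      misses : ¬ HitsAll C A
      misses h = ¬hit (size , h)

Disjoint : ∀ {n s} → (Fin s → Subset n) → Set
Disjoint F = ∀ i j {e} → e ∈ F i → e ∈ F j → i ≡ j

Overlap : ∀ {n s} → (Fin s → Subset n) → Set
Overlap C = ∃ λ i → ∃ λ j → i ≢ j × ∃ λ e → e ∈ C i × e ∈ C j

overlap-or-disjoint : ∀ {n s} (C : Fin s → Subset n) → Overlap C ⊎ Disjoint C
overlap-or-disjoint C with FinP.any? (λ i → FinP.any? (λ j →
  ¬? (i ≟ᶠ j) ×-dec FinP.any? (λ e → (e ∈? C i) ×-dec (e ∈? C j))))
... | yes clash = inj₁ clash
... | no ¬clash = inj₂ disjoint
  where
  disjoint : Disjoint C
  disjoint i j {e} e∈Ci e∈Cj with i ≟ᶠ j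
  ... | yes i≡j = i≡j
  ... | no i≢j = ⊥-elim (¬clash (i , j , i≢j , e , e∈Ci , e∈Cj))

multiplicity : ∀ {n s} → (Fin s → Subset n) → Fin n → ℕ
multiplicity {s = s} C e = ∑[ i < s ] ind (e ∈? C i)

∑multiplicity : ∀ {n s} (C : Fin s → Subset n) → ∑[ e < n ] multiplicity C e ≡ ∑[ i < s ] ∣ C i ∣
∑multiplicity C = trans (sym (∑-comm (λ i e → ind (e ∈? C i)))) (sum-cong-≗ (sym ∘ ∣∣≡∑∈ ∘ C))

∑∣disjoint∣≤n : ∀ {n s} (D : Fin s → Subset n) → Disjoint D → ∑[ i < s ] ∣ D i ∣ ≤ n
∑∣disjoint∣≤n {n} D disjoint = begin
  ∑[ i < _ ] ∣ D i ∣            ≡⟨ ∑multiplicity D ⟨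
  ∑[ e < n ] multiplicity D e   ≤⟨ ∑-mono (λ e → ∑-ind-≤1 (λ i → e ∈? D i) (λ i j → disjoint i j)) ⟩
  ∑[ e < n ] 1                  ≡⟨ ∑-ones n ⟩
  n ∎
  where open ≤-Reasoning

-- If the sizes sum to at most n but two members overlap, some point is free:
-- otherwise every point is counted once and the overlap point twice.
free-point : ∀ {n s} (C : Fin s → Subset n) → ∑[ i < s ] ∣ C i ∣ ≤ n → Overlap C → ∃ (Free C)
free-point {n} {s} C total≤n (i , j , i≢j , x , x∈Ci , x∈Cj) with FinP.any? (free? C)
... | yes free = free
... | no ¬free = ⊥-elim (<⇒≱ n<total total≤n)
  where
  covered : ∀ e → 1 ≤ multiplicity C e
  covered e with FinP.¬∀⟶∃¬ s (λ l → e ∉ C l) (λ l → ¬? (e ∈? C l)) (λ e-free → ¬free (e , e-free))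
  ... | l , ¬e∉Cl = ≤-trans (≤-reflexive (sym (ind-yes (decidable-stable (e ∈? C l) ¬e∉Cl) (e ∈? C l))))
                            (∑-term (λ l → ind (e ∈? C l)) l)
  doubly-covered : 1 < multiplicity C x
  doubly-covered = ≤-trans (≤-reflexive (sym (cong₂ _+_ (ind-yes x∈Ci (x ∈? C i)) (ind-yes x∈Cj (x ∈? C j)))))
                           (∑-two-terms (λ l → ind (x ∈? C l)) i≢j)
  n<total : n < ∑[ i < s ] ∣ C i ∣
  n<total = begin-strict
    n                             ≡⟨ ∑-ones n ⟨
    ∑[ e < n ] 1                  <⟨ ∑-mono-< covered x doubly-covered ⟩
    ∑[ e < n ] multiplicity C e   ≡⟨ ∑multiplicity C ⟩
    ∑[ i < s ] ∣ C i ∣ ∎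
    where open ≤-Reasoning

-- The number of free points, which compression strictly decreases.
#free : ∀ {n s} → (Fin s → Subset n) → ℕ
#free {n} C = ∑[ e < n ] ind (free? C e)

-- Compressing an overlap point x ∈ C i ∩ C j (i ≢ j) of C j onto a free y uses up y
-- and frees nothing, since x stays in C i.
#free-shift : ∀ {n s} (C : Fin s → Subset n) {i j} → i ≢ j → ∀ {x} → x ∈ C i → x ∈ C j → ∀ {y} → Free C y →
  #free (shift C j x y) < #free C
#free-shift {n} {s} C {i} {j} i≢j {x} x∈Ci x∈Cj {y} y-free =
  ∑-mono-< (λ e → ind-mono free-before (free? C′ e) (free? C e)) y
           (ind-< (λ y-free′ → y-free′ j (∈shift⁺ C j x y (subst (_∈ C j) (sym (τ-right x y)) x∈Cj)))
                  y-free (free? C′ y) (free? C y))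
  where
  C′ : Fin s → Subset n
  C′ = shift C j x y
  free-before : ∀ {e} → Free C′ e → Free C e
  free-before {e} e-free′ l e∈Cl with l ≟ᶠ j
  ... | no l≢j = e-free′ l (subst (_ ∈_) (sym (shift-other C j x y l l≢j)) e∈Cl)
  ... | yes refl with e ≟ᶠ x | e ≟ᶠ y
  ...   | yes refl | _ = e-free′ i (subst (_ ∈_) (sym (shift-other C l x y i i≢j)) x∈Ci)
  ...   | no _ | yes refl = y-free l e∈Cl
  ...   | no e≢x | no e≢y = e-free′ l (∈shift⁺ C l x y (subst (_∈ C l) (sym (τ-other x y e e≢x e≢y)) e∈Cl))

disjointify : ∀ {n s} k (C : Fin s → Subset n) → ∑[ i < s ] ∣ C i ∣ ≤ n → Acc _<_ (#free C) →
  ∃ λ C* → Disjoint C* × (∀ i → ∣ C* i ∣ ≡ ∣ C i ∣) × countHitting n k C* ≤ countHitting n k C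
disjointify k C total≤n (acc smaller) with overlap-or-disjoint C
... | inj₂ disjoint = C , disjoint , (λ _ → refl) , ≤-refl
... | inj₁ clash@(i , j , i≢j , x , x∈Ci , x∈Cj) with free-point C total≤n clash
...   | y , y-free with disjointify k (shift C j x y)
          (subst (_≤ _) (sym (sum-cong-≗ (∣shift∣ C j x y))) total≤n)
          (smaller (#free-shift C i≢j x∈Ci x∈Cj y-free))
...     | C* , disjoint , sizes , count≤ =
          C* , disjoint , (λ l → trans (sizes l) (∣shift∣ C j x y l)) ,
          ≤-trans count≤ (Compression.count-shift C j x y x∈Cj y-free k)

point-outside : ∀ {n} {A B : Subset n} {y : Fin n} → ∣ B ∣ ≤ ∣ A ∣ → y ∈ B → y ∉ A → ∃ λ x → x ∈ A × x ∉ B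
point-outside {A = A} {B} {y} ∣B∣≤∣A∣ y∈B y∉A with FinP.any? (λ x → (x ∈? A) ×-dec ¬? (x ∈? B))
... | yes found = found
... | no none = ⊥-elim (<⇒≱ (p⊂q⇒∣p∣<∣q∣ (A⊆B , y , y∈B , y∉A)) ∣B∣≤∣A∣)
  where
  A⊆B : A ⊆ B
  A⊆B {x} x∈A = decidable-stable (x ∈? B) (λ x∉B → none (x , x∈A , x∉B))

misplaced-or-covered : ∀ {n s} (C D : Fin s → Subset n) →
  (∃ λ j → ∃ λ y → y ∈ D j × y ∉ C j) ⊎ (∀ j → D j ⊆ C j)
misplaced-or-covered C D with FinP.any? (λ j → FinP.any? (λ y → (y ∈? D j) ×-dec ¬? (y ∈? C j)))
... | yes misplaced = inj₁ misplaced
... | no none = inj₂ (λ j {y} y∈Dj → decidable-stable (y ∈? C j) (λ y∉Cj → none (j , y , y∈Dj , y∉Cj)))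

#misplaced : ∀ {n s} → (Fin s → Subset n) → (Fin s → Subset n) → ℕ
#misplaced {s = s} D C = ∑[ l < s ] ∣ D l ∩ ∁ (C l) ∣

-- For disjoint families, the transposition (x y) with x ∈ C j ∖ D j and
-- y ∈ D j ∖ C j covers y by C j and uncovers no point of D.
module Realign {n s} (C D : Fin s → Subset n) (C-disjoint : Disjoint C) (D-disjoint : Disjoint D)
               {j : Fin s} {x y : Fin n} (x∈Cj : x ∈ C j) (x∉Dj : x ∉ D j) (y∈Dj : y ∈ D j) (y∉Cj : y ∉ C j) where

  C′ : Fin s → Subset n
  C′ = τˢ x y ∘ C

  y∈C′j : y ∈ C′ j
  y∈C′j = ∈τˢ⁺ x y (subst (_∈ C j) (sym (τ-right x y)) x∈Cj)

  still-covered : ∀ l {e} → e ∈ D l → e ∈ C l → e ∈ C′ l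
  still-covered l {e} e∈Dl e∈Cl with e ≟ᶠ x | e ≟ᶠ y
  ... | yes refl | _ with C-disjoint l j e∈Cl x∈Cj
  ...   | refl = ⊥-elim (x∉Dj e∈Dl)
  still-covered l {e} e∈Dl e∈Cl | no _ | yes refl with D-disjoint l j e∈Dl y∈Dj
  ...   | refl = y∈C′j
  still-covered l {e} e∈Dl e∈Cl | no e≢x | no e≢y = ∈τˢ⁺ x y (subst (_∈ C l) (sym (τ-other x y e e≢x e≢y)) e∈Cl)

  misplaced-⊆ : ∀ l → D l ∩ ∁ (C′ l) ⊆ D l ∩ ∁ (C l)
  misplaced-⊆ l {e} e∈ with x∈p∩q⁻ (D l) _ e∈
  ... | e∈Dl , e∈∁C′l = x∈p∩q⁺ (e∈Dl , x∉p⇒x∈∁p (x∈∁p⇒x∉p e∈∁C′l ∘ still-covered l e∈Dl))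

  #misplaced-< : #misplaced D C′ < #misplaced D C
  #misplaced-< = ∑-mono-< (λ l → p⊆q⇒∣p∣≤∣q∣ (misplaced-⊆ l)) j
    (p⊂q⇒∣p∣<∣q∣ (misplaced-⊆ j , y , x∈p∩q⁺ (y∈Dj , x∉p⇒x∈∁p y∉Cj) ,
                  λ y∈ → x∈∁p⇒x∉p (proj₂ (x∈p∩q⁻ (D j) _ y∈)) y∈C′j))

  C′-disjoint : Disjoint C′
  C′-disjoint i l e∈C′i e∈C′l = C-disjoint i l (∈τˢ⁻ x y e∈C′i) (∈τˢ⁻ x y e∈C′l)

disjoint-count : ∀ {n s} k (C D : Fin s → Subset n) → Disjoint C → Disjoint D →
  (∀ i → ∣ C i ∣ ≡ ∣ D i ∣) → Acc _<_ (#misplaced D C) → countHitting n k D ≤ countHitting n k C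
disjoint-count k C D C-disjoint D-disjoint sizes (acc smaller) with misplaced-or-covered C D
... | inj₂ D⊆C = count-mono k D C D⊆C
... | inj₁ (j , y , y∈Dj , y∉Cj) with point-outside (≤-reflexive (sym (sizes j))) y∈Dj y∉Cj
...   | x , x∈Cj , x∉Dj = subst (_ ≤_) (count-τ k x y C)
        (disjoint-count k (τˢ x y ∘ C) D C′-disjoint D-disjoint (λ i → trans (∣τˢ∣ x y (C i)) (sizes i))
          (smaller #misplaced-<))
  where open Realign C D C-disjoint D-disjoint x∈Cj x∉Dj y∈Dj y∉Cj

disjoint-from-empty : ∀ {n s} (D : Fin s → Subset n) → (∀ i j → i ≢ j → Empty (D i ∩ D j)) → Disjoint D
disjoint-from-empty D empty i j e∈Di e∈Dj with i ≟ᶠ j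
... | yes i≡j = i≡j
... | no i≢j = ⊥-elim (empty i j i≢j (meet e∈Di e∈Dj))

proposition10p2 : (n k s : ℕ) → k ≤ n → (C D : Fin s → Subset n) →
    (∀ i → ∣ C i ∣ ≡ ∣ D i ∣) →
    (∀ i j → i ≢ j → Empty (D i ∩ D j)) →
    countHitting n k D ≤ countHitting n k C
proposition10p2 n k s _ C D sizes D-empty =
  let C* , C*-disjoint , sizes* , count≤ = disjointify k C total≤n (<-wellFounded _)
  in  ≤-trans (disjoint-count k C* D C*-disjoint D-disjoint (λ i → trans (sizes* i) (sizes i)) (<-wellFounded _))
              count≤
  where
  D-disjoint : Disjoint D
  D-disjoint = disjoint-from-empty D D-empty
  total≤n : ∑[ i < s ] ∣ C i ∣ ≤ n
  total≤n = subst (_≤ n) (sym (sum-cong-≗ sizes)) (∑∣disjoint∣≤n D D-disjoint)
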